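{- Let $G$ be a graph without isolated vertices and let $k$ be the order of a total transitive partition of $G$. Then for every $j$ with $1\leq j\leq k$, $G$ has a total transitive partition of order $j$.
   Context: A total transitive partition of order $k$ of $G=(V,E)$ is a partition $\{V_1,\dots,V_k\}$ of $V$ into nonempty sets such that for all $1\leq i\leq j\leq k$, every vertex of $V_j$ has a neighbour in $V_i$ (for $i=j$: every vertex of $V_i$ is adjacent to another vertex of $V_i$). -}

module Defs where

open import Data.Nat using (ℕ)
open import Data.Fin using (Fin; _≤_)
open import Data.Product using (Σ; ∃; _×_)
open import Relation.Nullary using (¬_)
open import Relation.Binary.PropositionalEquality using (_≡_)
open import Relation.Binary.Definitions using (Decidable)
open import Level using (0ℓ)

record Graph (n : ℕ) : Set₁ where
  field
    Adj     : Fin n → Fin n → Set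
    adj?    : Decidable Adj
    sym     : ∀ {u v} → Adj u v → Adj v u
    irrefl  : ∀ {v} → ¬ Adj v v

open Graph public

NoIsolated : ∀ {n} → Graph n → Set
NoIsolated {n} G = ∀ (v : Fin n) → ∃ λ u → Adj G v u

-- A partition {V_1,...,V_k} of V into nonempty sets, encoded by the
-- class map p : V → Fin k (V_i = p⁻¹(i)); nonemptiness = surjectivity.
-- Total transitive: for all i ≤ j, every vertex of V_j has a neighbour
-- in V_i (for i = j this neighbour is another vertex, by irreflexivity).
record TotalTransitivePartition {n : ℕ} (G : Graph n) (k : ℕ) : Set where
  field
    part       : Fin n → Fin k
    nonempty   : ∀ (i : Fin k) → ∃ λ v → part v ≡ i
    transitive : ∀ (i j : Fin k) → i ≤ j → ∀ (v : Fin n) → part v ≡ j →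
                 ∃ λ u → Adj G v u × part u ≡ i

{-# OPTIONS --safe #-}
-- Merging the classes V_j, …, V_k of a total transitive partition into a
-- single class gives one of order j: a vertex of the merged class lies in
-- some V_l with l ≥ j, so it still has a neighbour in each V_i with i ≤ j,
-- and a neighbour in V_j lies in the merged class itself. The argument never
-- needs the absence of isolated vertices.
module Submission where

open import Defs
open import Data.Nat using (ℕ; suc; _≤_; _⊓_; s≤s)
open import Data.Nat.Properties using (m⊓n≤m; m⊓n≤n; m≤n⇒m⊓n≡m; module ≤-Reasoning)
open import Data.Fin as Fin using (Fin; toℕ; fromℕ<; inject≤)
open import Data.Fin.Properties using (toℕ-fromℕ<; toℕ-inject≤; toℕ-injective; toℕ≤pred[n])
open import Data.Product using (_,_; _×_; ∃)
open import Relation.Binary.PropositionalEquality using (_≡_; refl; cong; trans; module ≡-Reasoning)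

cap : ∀ {k} m → Fin k → Fin (suc m)
cap m c = fromℕ< (s≤s (m⊓n≤n (toℕ c) m))

toℕ-cap : ∀ {k} m (c : Fin k) → toℕ (cap m c) ≡ toℕ c ⊓ m
toℕ-cap m c = toℕ-fromℕ< _

cap-inject≤ : ∀ {m k} (i : Fin (suc m)) .(m<k : suc m ≤ k) → cap m (inject≤ i m<k) ≡ i
cap-inject≤ {m} i m<k = toℕ-injective (begin
  toℕ (cap m (inject≤ i m<k)) ≡⟨ toℕ-cap m (inject≤ i m<k) ⟩
  toℕ (inject≤ i m<k) ⊓ m     ≡⟨ cong (_⊓ m) (toℕ-inject≤ i m<k) ⟩
  toℕ i ⊓ m                   ≡⟨ m≤n⇒m⊓n≡m (toℕ≤pred[n] i) ⟩
  toℕ i                       ∎)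
  where open ≡-Reasoning

≤-cap⇒inject≤-≤ : ∀ {m k} {i : Fin (suc m)} (c : Fin k) .(m<k : suc m ≤ k) →
                  i Fin.≤ cap m c → inject≤ i m<k Fin.≤ c
≤-cap⇒inject≤-≤ {m} {i = i} c m<k i≤c = begin
  toℕ (inject≤ i m<k) ≡⟨ toℕ-inject≤ i m<k ⟩
  toℕ i               ≤⟨ i≤c ⟩
  toℕ (cap m c)       ≡⟨ toℕ-cap m c ⟩
  toℕ c ⊓ m           ≤⟨ m⊓n≤m (toℕ c) m ⟩
  toℕ c               ∎
  where open ≤-Reasoning

capPartition : ∀ {n k m} {G : Graph n} → TotalTransitivePartition G k →
               suc m ≤ k → TotalTransitivePartition G (suc m)
capPartition {n} {m = m} {G} P m<k = record
  { part       = capped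
  ; nonempty   = nonempty′
  ; transitive = transitive′
  }
  where
  open TotalTransitivePartition P

  capped : Fin n → Fin (suc m)
  capped v = cap m (part v)

  nonempty′ : ∀ i → ∃ λ v → capped v ≡ i
  nonempty′ i = let v , v∈i = nonempty (inject≤ i m<k) in
    v , trans (cong (cap m) v∈i) (cap-inject≤ i m<k)

  transitive′ : ∀ i j → i Fin.≤ j → ∀ v → capped v ≡ j → ∃ λ u → Adj G v u × capped u ≡ i
  transitive′ i _ i≤j v refl =
    let u , v~u , u∈i = transitive (inject≤ i m<k) (part v) (≤-cap⇒inject≤-≤ (part v) m<k i≤j) v refl
    in u , v~u , trans (cong (cap m) u∈i) (cap-inject≤ i m<k)

proposition7 : ∀ {n : ℕ} (G : Graph n) → NoIsolated G → (k : ℕ) →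
                 TotalTransitivePartition G k →
                 ∀ (j : ℕ) → 1 ≤ j → j ≤ k → TotalTransitivePartition G j
proposition7 G _ k P (suc m) _ m<k = capPartition P m<k
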